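{- Let $b\geq 2$ be an integer and let $n,d$ be positive integers. The infinite arithmetic progression $\{n+jd: j\geq 0\}$ contains a $b$-anti-Niven number if and only if $\gcd(n,d,b-1)=1$.
   Context: For a positive integer $n$ with base-$b$ expansion $n=\sum_{j=0}^m a_jb^j$ ($0\leq a_j\leq b-1$), $s_b(n)=\sum_{j=0}^m a_j$ denotes its base-$b$ digit sum. A positive integer $n$ is called $b$-anti-Niven if $\gcd(n,s_b(n))=1$. -}

module Defs where

open import Data.Nat using (ℕ; zero; suc; _+_; _*_; _≤_; _<_; NonZero)
open import Data.Nat.DivMod using (_/_; _%_)
open import Data.Nat.GCD using (gcd)

-- With fuel k = n this computes the full base-b digit
-- sum for every b ≥ 2 (n has at most n base-b digits).
digitSumAux : (b : ℕ) → .{{NonZero b}} → ℕ → ℕ → ℕ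
digitSumAux b zero    n = zero
digitSumAux b (suc k) zero = zero
digitSumAux b (suc k) (suc m) = (suc m % b) + digitSumAux b k (suc m / b)

digitSum : (b : ℕ) → .{{NonZero b}} → ℕ → ℕ
digitSum b n = digitSumAux b n n

AntiNiven : (b : ℕ) → .{{NonZero b}} → ℕ → Set
AntiNiven b n = (1 ≤ n) × (gcd n (digitSum b n) ≡ 1)
  where
  open import Data.Product using (_×_)
  open import Relation.Binary.PropositionalEquality using (_≡_)

{-# OPTIONS --safe #-}
-- Since s_b(m) ≡ m (mod b − 1), a common divisor of n, d and b − 1 divides every term m of
-- the progression together with s_b(m). Conversely, if gcd(n, d, b − 1) = 1, take a term n₀
-- coprime to b − 1 and a large K with S = s_b(n₀) + K(b − 1) coprime to n₀; such K exist
-- because s_b(n₀) is coprime to b − 1. Putting in front of the digits of n₀ those of a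
-- multiple of d S with digit sum K(b − 1), namely d S − 1 followed by its K-digit
-- (b − 1)-complement, gives a term m of the progression with s_b(m) = S and m ≡ n₀ (mod S),
-- so gcd(m, S) = 1.
module Submission where

open import Defs
open import Data.Nat
open import Data.Nat.Properties
open import Data.Nat.DivMod
open import Data.Nat.Divisibility
open import Data.Nat.GCD
open import Data.Nat.Coprimality using (Coprime; gcd≡1⇒coprime; coprime⇒gcd≡1; coprime-divisor)
  renaming (sym to coprime-sym)
open import Data.Nat.Induction using (<-rec)
open import Data.Nat.Tactic.RingSolver using (solve-∀)
open import Data.Product
open import Data.Sum using (inj₁; inj₂)
open import Function.Base using (_∘_)
open import Function.Bundles using (_⇔_; mk⇔)
open import Relation.Binary.PropositionalEquality
open import Relation.Nullary using (yes; no)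

∣m+n∣n⇒∣m : ∀ {d m n} → d ∣ m + n → d ∣ n → d ∣ m
∣m+n∣n⇒∣m {d} {m} {n} d∣m+n = ∣m+n∣m⇒∣n (subst (d ∣_) (+-comm m n) d∣m+n)

coprime-+-multiple : ∀ {m n} k → Coprime m n → Coprime (m + n * k) n
coprime-+-multiple k m⊥n (i∣m+nk , i∣n) = m⊥n (∣m+n∣n⇒∣m i∣m+nk (∣m⇒∣m*n k i∣n) , i∣n)

CoprimePart : ℕ → ℕ → ℕ → Set
CoprimePart a N t = Coprime t a × (∀ {e} → e ∣ N → Coprime e a → e ∣ t)

gcd≢1⇒nonTrivial : ∀ N a .{{_ : NonZero N}} → gcd N a ≢ 1 → NonTrivial (gcd N a)
gcd≢1⇒nonTrivial N a g≢1 =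
  n>1⇒nonTrivial (≤∧≢⇒< (n≢0⇒n>0 (gcd[m,n]≢0 N a (inj₁ (≢-nonZero⁻¹ N)))) (g≢1 ∘ sym))

-- Divide N by gcd N a until that gcd becomes 1.
coprime-part : ∀ a N → 1 ≤ N → ∃ (CoprimePart a N)
coprime-part a = <-rec (λ N → 1 ≤ N → ∃ (CoprimePart a N)) step
  where
  step : ∀ N → (∀ {M} → M < N → 1 ≤ M → ∃ (CoprimePart a M)) → 1 ≤ N → ∃ (CoprimePart a N)
  step N rec 1≤N with gcd N a ≟ 1
  ... | yes g≡1 = N , gcd≡1⇒coprime g≡1 , λ e∣N _ → e∣N
  ... | no g≢1 = lift (rec (quotient-< g∣N) (>-nonZero⁻¹ _ {{quotient≢0 g∣N}}))
    where
    instance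
      N≢0 : NonZero N
      N≢0 = >-nonZero 1≤N
      g-nonTrivial : NonTrivial (gcd N a)
      g-nonTrivial = gcd≢1⇒nonTrivial N a g≢1
    g∣N = gcd[m,n]∣m N a
    lift : ∃ (CoprimePart a (quotient g∣N)) → ∃ (CoprimePart a N)
    lift (t , t⊥a , t-max) = t , t⊥a , λ e∣N e⊥a → t-max (e∣quotient e∣N e⊥a) e⊥a
      where
      e∣quotient : ∀ {e} → e ∣ N → Coprime e a → e ∣ quotient g∣N
      e∣quotient {e} e∣N e⊥a = coprime-divisor e⊥g (subst (e ∣_) (m∣n⇒n≡m*quotient g∣N) e∣N)
        where
        e⊥g : Coprime e (gcd N a)
        e⊥g (i∣e , i∣g) = e⊥a (i∣e , ∣-trans i∣g (gcd[m,n]∣n N a))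

-- Take t to be the part of N coprime to a: a common divisor of a + t * c and N is then
-- coprime to a, hence divides t, hence divides a.
coprime-in-progression : ∀ a c N → 1 ≤ N → (∀ {h} → h ∣ a → h ∣ c → h ∣ N → h ≡ 1) →
  ∃ λ t → Coprime (a + t * c) N
coprime-in-progression a c N 1≤N no-common-divisor with coprime-part a N 1≤N
... | t , t⊥a , t-max = t , λ (e∣a+tc , e∣N) → e⊥a e∣a+tc e∣N (∣-refl , ∣m+n∣n⇒∣m e∣a+tc (e∣tc e∣a+tc e∣N))
  where
  e⊥a : ∀ {e} → e ∣ a + t * c → e ∣ N → Coprime e a
  e⊥a e∣a+tc e∣N (h∣e , h∣a) = no-common-divisor h∣a h∣c (∣-trans h∣e e∣N)
    where
    h⊥t : Coprime _ t
    h⊥t (i∣h , i∣t) = t⊥a (i∣t , ∣-trans i∣h h∣a)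
    h∣c = coprime-divisor h⊥t (∣m+n∣m⇒∣n (∣-trans h∣e e∣a+tc) h∣a)
  e∣tc : ∀ {e} → e ∣ a + t * c → e ∣ N → e ∣ t * c
  e∣tc e∣a+tc e∣N = ∣m⇒∣m*n c (t-max e∣N (e⊥a e∣a+tc e∣N))

n<2^n : ∀ n → n < 2 ^ n
n<2^n zero = s≤s z≤n
n<2^n (suc n) = begin
  2 + n         ≤⟨ +-monoʳ-≤ 1 (n<2^n n) ⟩
  1 + 2 ^ n     ≤⟨ +-monoˡ-≤ (2 ^ n) (m^n>0 2 n) ⟩
  2 ^ n + 2 ^ n ≡⟨ cong (2 ^ n +_) (+-identityʳ (2 ^ n)) ⟨
  2 ^ suc n     ∎
  where open ≤-Reasoning

-- From m (4m + 1) ≤ (2m + 1)² ≤ 2 ^ 4m, each further step doubles the right side but adds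
-- only m to the left.
m*[1+n]≤2^n : ∀ m n → 4 * m ≤ n → m * suc n ≤ 2 ^ n
m*[1+n]≤2^n m n 4m≤n = subst (λ k → m * suc k ≤ 2 ^ k) (m+[n∸m]≡n 4m≤n) (from-4m (n ∸ 4 * m))
  where
  open ≤-Reasoning
  square : ∀ m → m * suc (4 * m + 0) + (3 * m + 1) ≡ suc (2 * m) * suc (2 * m)
  square = solve-∀
  [2m+2m]≡[4m+0] : ∀ m → 2 * m + 2 * m ≡ 4 * m + 0
  [2m+2m]≡[4m+0] = solve-∀
  from-4m : ∀ j → m * suc (4 * m + j) ≤ 2 ^ (4 * m + j)
  from-4m zero = begin
    m * suc (4 * m + 0)               ≤⟨ m≤m+n _ (3 * m + 1) ⟩
    m * suc (4 * m + 0) + (3 * m + 1) ≡⟨ square m ⟩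
    suc (2 * m) * suc (2 * m)         ≤⟨ *-mono-≤ (n<2^n (2 * m)) (n<2^n (2 * m)) ⟩
    2 ^ (2 * m) * 2 ^ (2 * m)         ≡⟨ ^-distribˡ-+-* 2 (2 * m) (2 * m) ⟨
    2 ^ (2 * m + 2 * m)               ≡⟨ cong (2 ^_) ([2m+2m]≡[4m+0] m) ⟩
    2 ^ (4 * m + 0)                   ∎
  from-4m (suc j) = begin
    m * suc (4 * m + suc j) ≡⟨ cong (λ k → m * suc k) (+-suc (4 * m) j) ⟩
    m * suc (suc k)         ≡⟨ *-suc m (suc k) ⟩
    m + m * suc k           ≤⟨ +-mono-≤ (≤-trans (m≤m*n m (suc k)) (from-4m j)) (from-4m j) ⟩
    2 ^ k + 2 ^ k           ≡⟨ cong (2 ^ k +_) (+-identityʳ (2 ^ k)) ⟨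
    2 ^ suc k               ≡⟨ cong (2 ^_) (+-suc (4 * m) j) ⟨
    2 ^ (4 * m + suc j)     ∎
    where
    k = 4 * m + j

module Digits (B : ℕ) (1≤B : 1 ≤ B) where

  b : ℕ
  b = suc B

  -- digitSumAux without the case split on 0, so that it unfolds on variable arguments.
  lowDigitSum : ℕ → ℕ → ℕ
  lowDigitSum zero    y = 0
  lowDigitSum (suc k) y = y % b + lowDigitSum k (y / b)

  lowDigitSum-0 : ∀ k → lowDigitSum k 0 ≡ 0
  lowDigitSum-0 zero    = refl
  lowDigitSum-0 (suc k) = lowDigitSum-0 k

  digitSumAux≡lowDigitSum : ∀ k y → digitSumAux b k y ≡ lowDigitSum k y
  digitSumAux≡lowDigitSum zero    y       = refl
  digitSumAux≡lowDigitSum (suc k) zero    = sym (lowDigitSum-0 k)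
  digitSumAux≡lowDigitSum (suc k) (suc y) = cong (suc y % b +_) (digitSumAux≡lowDigitSum k (suc y / b))

  /b<b^ : ∀ {y} k → y < b ^ suc k → y / b < b ^ k
  /b<b^ {y} k y<b^[1+k] = m<n*o⇒m/o<n (subst (y <_) (*-comm b (b ^ k)) y<b^[1+k])

  lowDigitSum-pad : ∀ k j y → y < b ^ k → lowDigitSum (k + j) y ≡ lowDigitSum k y
  lowDigitSum-pad zero    j zero    _  = lowDigitSum-0 j
  lowDigitSum-pad zero    j (suc y) (s≤s ())
  lowDigitSum-pad (suc k) j y       lt = cong (y % b +_) (lowDigitSum-pad k j (y / b) (/b<b^ k lt))

  lowDigitSum-stable : ∀ {k k′ y} → y < b ^ k → k ≤ k′ → lowDigitSum k′ y ≡ lowDigitSum k y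
  lowDigitSum-stable {k} {k′} {y} lt k≤k′ =
    trans (cong (λ l → lowDigitSum l y) (sym (m+[n∸m]≡n k≤k′))) (lowDigitSum-pad k (k′ ∸ k) y lt)

  n<b^n : ∀ n → n < b ^ n
  n<b^n n = ≤-trans (n<2^n n) (^-monoˡ-≤ n (s≤s 1≤B))

  digitSum≡lowDigitSum : ∀ k y → y < b ^ k → digitSum b y ≡ lowDigitSum k y
  digitSum≡lowDigitSum k y lt with ≤-total k y
  ... | inj₁ k≤y = trans (digitSumAux≡lowDigitSum y y) (lowDigitSum-stable lt k≤y)
  ... | inj₂ y≤k = trans (digitSumAux≡lowDigitSum y y) (sym (lowDigitSum-stable (n<b^n y) y≤k))

  [r+q*b]%b≡r : ∀ {r} q → r < b → (r + q * b) % b ≡ r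
  [r+q*b]%b≡r {r} q r<b = trans ([m+kn]%n≡m%n r q b) (m<n⇒m%n≡m r<b)

  [r+q*b]/b≡q : ∀ {r} q → r < b → (r + q * b) / b ≡ q
  [r+q*b]/b≡q {r} q r<b = begin
    (r + q * b) / b   ≡⟨ +-distrib-/-∣ʳ r (n∣m*n q) ⟩
    r / b + q * b / b ≡⟨ cong₂ _+_ (m<n⇒m/n≡0 r<b) (m*n/n≡m q b) ⟩
    q                 ∎
    where open ≡-Reasoning

  lowDigitSum≡mod-B : ∀ k y → y < b ^ k → ∃ λ q → lowDigitSum k y + B * q ≡ y
  lowDigitSum≡mod-B zero    zero    _ = 0 , *-zeroʳ B
  lowDigitSum≡mod-B zero    (suc y) (s≤s ())
  lowDigitSum≡mod-B (suc k) y       lt with lowDigitSum≡mod-B k (y / b) (/b<b^ k lt)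
  ... | q , ih = q + y / b , (begin
    y % b + lowDigitSum k (y / b) + B * (q + y / b)   ≡⟨ regroup (y % b) (lowDigitSum k (y / b)) q (y / b) B ⟩
    y % b + (lowDigitSum k (y / b) + B * q) + B * (y / b) ≡⟨ cong (λ w → y % b + w + B * (y / b)) ih ⟩
    y % b + y / b + B * (y / b)                       ≡⟨ collect (y % b) (y / b) B ⟩
    y % b + y / b * b                                 ≡⟨ m≡m%n+[m/n]*n y b ⟨
    y                                                 ∎)
    where
    open ≡-Reasoning
    regroup : ∀ r s q t B → r + s + B * (q + t) ≡ r + (s + B * q) + B * t
    regroup = solve-∀
    collect : ∀ r t B → r + t + B * t ≡ r + t * suc B
    collect = solve-∀

  digitSum≡mod-B : ∀ y → ∃ λ q → digitSum b y + B * q ≡ y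
  digitSum≡mod-B y with lowDigitSum≡mod-B y y (n<b^n y)
  ... | q , eq = q , trans (cong (_+ B * q) (digitSumAux≡lowDigitSum y y)) eq

  ∣B⇒∣⇒∣digitSum : ∀ {e y} → e ∣ B → e ∣ y → e ∣ digitSum b y
  ∣B⇒∣⇒∣digitSum {e} {y} e∣B e∣y with digitSum≡mod-B y
  ... | q , eq = ∣m+n∣n⇒∣m (subst (e ∣_) (sym eq) e∣y) (∣m⇒∣m*n q e∣B)

  ∣B⇒∣digitSum⇒∣ : ∀ {e y} → e ∣ B → e ∣ digitSum b y → e ∣ y
  ∣B⇒∣digitSum⇒∣ {e} {y} e∣B e∣s with digitSum≡mod-B y
  ... | q , eq = subst (e ∣_) eq (∣m∣n⇒∣m+n e∣s (∣m⇒∣m*n q e∣B))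

  lowDigitSum-append : ∀ L K x y → x < b ^ L →
    lowDigitSum (L + K) (x + b ^ L * y) ≡ lowDigitSum L x + lowDigitSum K y
  lowDigitSum-append zero    K zero    y _  = cong (lowDigitSum K) (*-identityˡ y)
  lowDigitSum-append zero    K (suc x) y (s≤s ())
  lowDigitSum-append (suc L) K x       y lt = begin
    lowDigitSum (suc L + K) (x + b ^ suc L * y)         ≡⟨ cong (lowDigitSum (suc L + K)) x+b^[1+L]*y≡ ⟩
    lowDigitSum (suc L + K) (x % b + (x / b + b ^ L * y) * b)
      ≡⟨ cong₂ (λ r w → r + lowDigitSum (L + K) w) ([r+q*b]%b≡r q x%b<b) ([r+q*b]/b≡q q x%b<b) ⟩
    x % b + lowDigitSum (L + K) (x / b + b ^ L * y)     ≡⟨ cong (x % b +_) (lowDigitSum-append L K (x / b) y (/b<b^ L lt)) ⟩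
    x % b + (lowDigitSum L (x / b) + lowDigitSum K y)   ≡⟨ +-assoc (x % b) _ _ ⟨
    lowDigitSum (suc L) x + lowDigitSum K y             ∎
    where
    open ≡-Reasoning
    x%b<b = m%n<n x b
    q = x / b + b ^ L * y
    shift : ∀ r q P y b → r + q * b + b * P * y ≡ r + (q + P * y) * b
    shift = solve-∀
    x+b^[1+L]*y≡ : x + b ^ suc L * y ≡ x % b + (x / b + b ^ L * y) * b
    x+b^[1+L]*y≡ = trans (cong (_+ b ^ suc L * y) (m≡m%n+[m/n]*n x b)) (shift (x % b) (x / b) (b ^ L) y b)

  x+b^L*y<b^[L+M] : ∀ {L M x y} → x < b ^ L → y < b ^ M → x + b ^ L * y < b ^ (L + M)
  x+b^L*y<b^[L+M] {L} {M} {x} {y} x<b^L y<b^M = begin-strict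
    x + b ^ L * y     <⟨ +-monoˡ-< (b ^ L * y) x<b^L ⟩
    b ^ L + b ^ L * y ≡⟨ *-suc (b ^ L) y ⟨
    b ^ L * suc y     ≤⟨ *-monoʳ-≤ (b ^ L) y<b^M ⟩
    b ^ L * b ^ M     ≡⟨ ^-distribˡ-+-* b L M ⟨
    b ^ (L + M)       ∎
    where open ≤-Reasoning

  digitSum-append : ∀ L x y → x < b ^ L → digitSum b (x + b ^ L * y) ≡ digitSum b x + digitSum b y
  digitSum-append L x y x<b^L = begin
    digitSum b (x + b ^ L * y)          ≡⟨ digitSum≡lowDigitSum (L + y) _ (x+b^L*y<b^[L+M] {L} {y} x<b^L (n<b^n y)) ⟩
    lowDigitSum (L + y) (x + b ^ L * y) ≡⟨ lowDigitSum-append L y x y x<b^L ⟩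
    lowDigitSum L x + lowDigitSum y y   ≡⟨ cong₂ _+_ (digitSum≡lowDigitSum L x x<b^L) (digitSum≡lowDigitSum y y (n<b^n y)) ⟨
    digitSum b x + digitSum b y         ∎
    where open ≡-Reasoning

  complement : ℕ → ℕ → ℕ
  complement zero    y = 0
  complement (suc k) y = (B ∸ y % b) + complement k (y / b) * b

  B∸digit<b : ∀ y → B ∸ y % b < b
  B∸digit<b y = s≤s (m∸n≤m B (y % b))

  digit+[B∸digit]≡B : ∀ y → y % b + (B ∸ y % b) ≡ B
  digit+[B∸digit]≡B y = m+[n∸m]≡n (≤-pred (m%n<n y b))

  +complement+1≡b^ : ∀ k y → y < b ^ k → y + complement k y + 1 ≡ b ^ k
  +complement+1≡b^ zero    zero    _ = refl
  +complement+1≡b^ zero    (suc y) (s≤s ())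
  +complement+1≡b^ (suc k) y       lt = begin
    y + (B ∸ r + z * b) + 1          ≡⟨ cong (λ w → w + (B ∸ r + z * b) + 1) (m≡m%n+[m/n]*n y b) ⟩
    r + q * b + (B ∸ r + z * b) + 1  ≡⟨ regroup r q (B ∸ r) z B ⟩
    (r + (B ∸ r)) + 1 + (q + z) * b  ≡⟨ cong (λ w → w + 1 + (q + z) * b) (digit+[B∸digit]≡B y) ⟩
    B + 1 + (q + z) * b              ≡⟨ collect q z B ⟩
    (q + z + 1) * b                  ≡⟨ cong (_* b) (+complement+1≡b^ k q (/b<b^ k lt)) ⟩
    b ^ k * b                        ≡⟨ *-comm (b ^ k) b ⟩
    b ^ suc k                        ∎
    where
    open ≡-Reasoning
    r = y % b
    q = y / b
    z = complement k q
    regroup : ∀ r q s z B → r + q * suc B + (s + z * suc B) + 1 ≡ (r + s) + 1 + (q + z) * suc B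
    regroup = solve-∀
    collect : ∀ q z B → B + 1 + (q + z) * suc B ≡ (q + z + 1) * suc B
    collect = solve-∀

  lowDigitSum-complement : ∀ k y → lowDigitSum k (complement k y) + lowDigitSum k y ≡ k * B
  lowDigitSum-complement zero    y = refl
  lowDigitSum-complement (suc k) y = begin
    lowDigitSum (suc k) (B ∸ r + z * b) + (r + lowDigitSum k q)
      ≡⟨ cong₂ (λ s w → s + lowDigitSum k w + (r + lowDigitSum k q)) ([r+q*b]%b≡r z (B∸digit<b y)) ([r+q*b]/b≡q z (B∸digit<b y)) ⟩
    B ∸ r + lowDigitSum k z + (r + lowDigitSum k q) ≡⟨ regroup (B ∸ r) (lowDigitSum k z) r (lowDigitSum k q) ⟩
    (r + (B ∸ r)) + (lowDigitSum k z + lowDigitSum k q) ≡⟨ cong₂ _+_ (digit+[B∸digit]≡B y) (lowDigitSum-complement k q) ⟩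
    B + k * B                                       ∎
    where
    open ≡-Reasoning
    r = y % b
    q = y / b
    z = complement k q
    regroup : ∀ s c r d → s + c + (r + d) ≡ (r + s) + (c + d)
    regroup = solve-∀

  multiple-with-digitSum : ∀ K x → 1 ≤ x → x ≤ b ^ K → ∃ λ c → digitSum b (x * c) ≡ K * B
  multiple-with-digitSum K (suc y) _ y<b^K = y + z , (begin
    digitSum b (suc y * (y + z))      ≡⟨ cong (digitSum b) x*[y+z]≡z+b^K*y ⟩
    digitSum b (z + b ^ K * y)        ≡⟨ digitSum-append K z y z<b^K ⟩
    digitSum b z + digitSum b y       ≡⟨ cong₂ _+_ (digitSum≡lowDigitSum K z z<b^K) (digitSum≡lowDigitSum K y y<b^K) ⟩
    lowDigitSum K z + lowDigitSum K y ≡⟨ lowDigitSum-complement K y ⟩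
    K * B                             ∎)
    where
    open ≡-Reasoning
    z = complement K y
    y+z+1≡b^K : y + z + 1 ≡ b ^ K
    y+z+1≡b^K = +complement+1≡b^ K y y<b^K
    z<b^K : z < b ^ K
    z<b^K = ≤-trans (s≤s (m≤n+m z y)) (≤-reflexive (trans (+-comm 1 (y + z)) y+z+1≡b^K))
    expand : ∀ y z → suc y * (y + z) ≡ z + (y + z + 1) * y
    expand = solve-∀
    x*[y+z]≡z+b^K*y : suc y * (y + z) ≡ z + b ^ K * y
    x*[y+z]≡z+b^K*y = trans (expand y z) (cong (λ w → z + w * y) y+z+1≡b^K)

  d*[A+K*B]≤b^K : ∀ d A K → 4 * (d * (A + B)) ≤ K → d * (A + K * B) ≤ b ^ K
  d*[A+K*B]≤b^K d A K 4d[A+B]≤K = begin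
    d * (A + K * B)       ≤⟨ *-monoʳ-≤ d (subst (A + K * B ≤_) (expand A B K) (m≤m+n (A + K * B) (A * K + B))) ⟩
    d * ((A + B) * suc K) ≡⟨ *-assoc d (A + B) (suc K) ⟨
    d * (A + B) * suc K   ≤⟨ m*[1+n]≤2^n (d * (A + B)) K 4d[A+B]≤K ⟩
    2 ^ K                 ≤⟨ ^-monoˡ-≤ K (s≤s 1≤B) ⟩
    b ^ K                 ∎
    where
    open ≤-Reasoning
    expand : ∀ A B K → A + K * B + (A * K + B) ≡ (A + B) * suc K
    expand = solve-∀

  antiNiven-in-progression : ∀ {n₀ d} K → let S = digitSum b n₀ + K * B in
    1 ≤ n₀ → 1 ≤ d → 1 ≤ K → d * S ≤ b ^ K → Coprime S n₀ → ∃ λ j → AntiNiven b (n₀ + j * d)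
  antiNiven-in-progression {n₀} {d} K 1≤n₀ 1≤d 1≤K dS≤b^K S⊥n₀ =
    j , ≤-trans 1≤n₀ (m≤m+n n₀ (j * d)) , gcd[m,digitSum]≡1
    where
    S = digitSum b n₀ + K * B
    1≤dS : 1 ≤ d * S
    1≤dS = *-mono-≤ 1≤d (≤-trans (*-mono-≤ 1≤K 1≤B) (m≤n+m (K * B) (digitSum b n₀)))
    c = proj₁ (multiple-with-digitSum K (d * S) 1≤dS dS≤b^K)
    digitSum[dSc]≡KB : digitSum b (d * S * c) ≡ K * B
    digitSum[dSc]≡KB = proj₂ (multiple-with-digitSum K (d * S) 1≤dS dS≤b^K)
    j = b ^ n₀ * (S * c)
    m = n₀ + j * d
    digitSum[m]≡S : digitSum b m ≡ S
    digitSum[m]≡S = begin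
      digitSum b m                           ≡⟨ cong (digitSum b) (as-append n₀ (b ^ n₀) S c d) ⟩
      digitSum b (n₀ + b ^ n₀ * (d * S * c)) ≡⟨ digitSum-append n₀ n₀ (d * S * c) (n<b^n n₀) ⟩
      digitSum b n₀ + digitSum b (d * S * c) ≡⟨ cong (digitSum b n₀ +_) digitSum[dSc]≡KB ⟩
      S                                      ∎
      where
      open ≡-Reasoning
      as-append : ∀ n P S c d → n + P * (S * c) * d ≡ n + P * (d * S * c)
      as-append = solve-∀
    m⊥S : Coprime m S
    m⊥S = subst (λ w → Coprime w S) (sym (as-multiple n₀ (b ^ n₀) S c d))
            (coprime-+-multiple (b ^ n₀ * c * d) (coprime-sym S⊥n₀))
      where
      as-multiple : ∀ n P S c d → n + P * (S * c) * d ≡ n + S * (P * c * d)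
      as-multiple = solve-∀
    gcd[m,digitSum]≡1 : gcd m (digitSum b m) ≡ 1
    gcd[m,digitSum]≡1 = subst (λ w → gcd m w ≡ 1) (sym digitSum[m]≡S) (coprime⇒gcd≡1 m⊥S)

  exponent-for-antiNiven : ∀ {n₀} d → 1 ≤ n₀ → 1 ≤ d → Coprime n₀ B →
    ∃ λ K → let S = digitSum b n₀ + K * B in 1 ≤ K × d * S ≤ b ^ K × Coprime S n₀
  exponent-for-antiNiven {n₀} d 1≤n₀ 1≤d n₀⊥B = K , 1≤K , d*[A+K*B]≤b^K d A K C≤K , S⊥n₀
    where
    instance
      n₀≢0 : NonZero n₀
      n₀≢0 = >-nonZero 1≤n₀
    A = digitSum b n₀
    A⊥B : Coprime A B
    A⊥B (i∣A , i∣B) = n₀⊥B (∣B⇒∣digitSum⇒∣ i∣B i∣A , i∣B)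
    K₀-choice = coprime-in-progression A B n₀ 1≤n₀ (λ h∣A h∣B _ → A⊥B (h∣A , h∣B))
    K₀ = proj₁ K₀-choice
    C = 4 * (d * (A + B))
    K = K₀ + n₀ * C
    C≤K : C ≤ K
    C≤K = ≤-trans (m≤n*m C n₀) (m≤n+m (n₀ * C) K₀)
    1≤K : 1 ≤ K
    1≤K = ≤-trans (≤-trans (*-mono-≤ 1≤d (≤-trans 1≤B (m≤n+m B A))) (m≤n*m (d * (A + B)) 4)) C≤K
    S⊥n₀ : Coprime (A + K * B) n₀
    S⊥n₀ = subst (λ w → Coprime w n₀) (regroup A K₀ B n₀ C) (coprime-+-multiple (C * B) (proj₂ K₀-choice))
      where
      regroup : ∀ A K₀ B n₀ C → A + K₀ * B + n₀ * (C * B) ≡ A + (K₀ + n₀ * C) * B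
      regroup = solve-∀

theorem2p2 : (b : ℕ) → .{{_ : NonZero b}} → 2 ≤ b → (n d : ℕ) → 1 ≤ n → 1 ≤ d →
    (∃ λ j → AntiNiven b (n + j * d)) ⇔ (gcd (gcd n d) (b ∸ 1) ≡ 1)
theorem2p2 (suc B) (s≤s 1≤B) n d 1≤n 1≤d = mk⇔ fwd bwd
  where
  open Digits B 1≤B
  g = gcd (gcd n d) B
  fwd : ∃ (λ j → AntiNiven b (n + j * d)) → g ≡ 1
  fwd (j , _ , gcd≡1) = ∣1⇒≡1 (subst (g ∣_) gcd≡1 (gcd-greatest g∣m (∣B⇒∣⇒∣digitSum g∣B g∣m)))
    where
    g∣B = gcd[m,n]∣n (gcd n d) B
    g∣n = ∣-trans (gcd[m,n]∣m (gcd n d) B) (gcd[m,n]∣m n d)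
    g∣d = ∣-trans (gcd[m,n]∣m (gcd n d) B) (gcd[m,n]∣n n d)
    g∣m : g ∣ n + j * d
    g∣m = ∣m∣n⇒∣m+n g∣n (∣n⇒∣m*n j g∣d)
  common-divisor≡1 : g ≡ 1 → ∀ {e} → e ∣ n → e ∣ d → e ∣ B → e ≡ 1
  common-divisor≡1 g≡1 e∣n e∣d e∣B = ∣1⇒≡1 (subst (_ ∣_) g≡1 (gcd-greatest (gcd-greatest e∣n e∣d) e∣B))
  1≤n+t*d : ∀ t → 1 ≤ n + t * d
  1≤n+t*d t = ≤-trans 1≤n (m≤m+n n (t * d))
  +-*-reassoc : ∀ n t j d → n + t * d + j * d ≡ n + (t + j) * d
  +-*-reassoc = solve-∀
  bwd : g ≡ 1 → ∃ λ j → AntiNiven b (n + j * d)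
  bwd g≡1 =
    let t , n₀⊥B = coprime-in-progression n d B 1≤B (common-divisor≡1 g≡1)
        K , 1≤K , dS≤b^K , S⊥n₀ = exponent-for-antiNiven d (1≤n+t*d t) 1≤d n₀⊥B
        j , antiNiven = antiNiven-in-progression K (1≤n+t*d t) 1≤d 1≤K dS≤b^K S⊥n₀
    in t + j , subst (AntiNiven b) (+-*-reassoc n t j d) antiNiven
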